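{- Let $1\le k\le r$, $0\le a\le r-1$, and let $G$ be a sub-hypergraph of $\Gamma_{k,r}^a$ with at least one hyperedge. Then there exists $\sigma\in E(G)$ such that $G$ is leaf-equivalent to $G\setminus\{\sigma\}$. In particular, $\Gamma_{k,r}^a$ is leaf-equivalent to the empty $k$-uniform hypergraph.
   Context: $\Gamma_{k,r}^a$ is the $k$-uniform hypergraph with vertex set $\{1,\dots,r\}$ whose hyperedges are the $(i_1,\dots,i_k)$ with $1\le i_1<\dots<i_k\le r$ and $i_1+\dots+i_k\equiv a+t\pmod r$ for some $0\le t\le k-1$. A sub-hypergraph $G$ has the same vertex set and a subset $E(G)$ of the hyperedges. For a $k$-uniform hypergraph $\Gamma$ and $\sigma=(i_1,\dots,i_k)\in E(\Gamma)$: if some $(k-1)$-face $(i_1,\dots,\widehat{i_s},\dots,i_k)$ of $\sigma$ is not contained in any other hyperedge of $\Gamma$, then $\Gamma$ and $\Gamma\setminus\{\sigma\}$ (same vertex set, $\sigma$ removed) are called leaf-equivalent (via that face). A $k$-uniform hypergraph $\Gamma$ on vertex set $V$ is leaf-equivalent to the empty $k$-uniform hypergraph if there is a chain $\emptyset=\Gamma_0\subset\Gamma_1\subset\dots\subset\Gamma_n=\Gamma$ of $k$-uniform hypergraphs on $V$ such that for each $1\le i\le n$, $\Gamma_{i-1}=\Gamma_i\setminus\{\sigma_i\}$ for some $\sigma_i\in E(\Gamma_i)$ with $\Gamma_i$ and $\Gamma_{i-1}$ leaf-equivalent. -}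

module Defs where

open import Data.Nat using (ℕ; zero; suc; _+_; _≤_; _<_; NonZero)
open import Data.Nat.DivMod using (_%_)
import Data.Nat.Properties as ℕP
open import Data.Fin using (Fin; zero; suc)
open import Data.Vec using (Vec; []; _∷_)
import Data.Vec.Properties as VP
open import Data.List using (List; []; _∷_; filter)
open import Data.List.Membership.Propositional using (_∈_; _∉_)
open import Data.List.Relation.Unary.All using (All)
open import Data.Product using (Σ; ∃; _×_)
open import Relation.Nullary using (¬_; ¬?)
open import Relation.Binary.PropositionalEquality using (_≡_; _≢_)

Hyperedge : ℕ → Set
Hyperedge k = Vec ℕ k

-- A k-uniform hypergraph (on a fixed vertex set) is given by its finite
-- set of hyperedges, represented as a list (read as a set: membership only).
Hypergraph : ℕ → Set
Hypergraph k = List (Hyperedge k)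

vsum : ∀ {k} → Vec ℕ k → ℕ
vsum []       = 0
vsum (x ∷ xs) = x + vsum xs

data Increasing : ∀ {k} → Vec ℕ k → Set where
  inc[]  : Increasing []
  inc[x] : ∀ x → Increasing (x ∷ [])
  inc∷   : ∀ {k} x y (ys : Vec ℕ k) → x < y → Increasing (y ∷ ys) →
           Increasing (x ∷ y ∷ ys)

data InRange (r : ℕ) : ∀ {k} → Vec ℕ k → Set where
  rng[] : InRange r []
  rng∷  : ∀ {k} x (xs : Vec ℕ k) → 1 ≤ x → x ≤ r → InRange r xs →
          InRange r (x ∷ xs)

IsEdgeΓ : (k r a : ℕ) .{{_ : NonZero r}} → Hyperedge k → Set
IsEdgeΓ k r a σ =
  Increasing σ × InRange r σ ×
  (Σ ℕ λ t → t < k × (vsum σ % r ≡ (a + t) % r))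

face : ∀ {k} → Hyperedge k → Fin k → List ℕ
face (x ∷ xs) zero    = Data.Vec.toList xs
face (x ∷ xs) (suc s) = x ∷ face xs s

_⊆ₑ_ : ∀ {k} → List ℕ → Hyperedge k → Set
_⊆ₑ_ {k} f τ = All (λ x → x Data.Vec.Membership.Propositional.∈ τ) f
  where import Data.Vec.Membership.Propositional

_∖_ : ∀ {k} → Hypergraph k → Hyperedge k → Hypergraph k
G ∖ σ = filter (λ τ → ¬? (VP.≡-dec ℕP._≟_ τ σ)) G

-- G and G ∖ {σ} are leaf-equivalent (via some face of σ):
-- σ ∈ E(G) and some (k-1)-face of σ lies in no other hyperedge of G.
LeafStep : ∀ {k} → Hypergraph k → Hyperedge k → Set
LeafStep {k} G σ =
  σ ∈ G × (Σ (Fin k) λ s → ∀ τ → τ ∈ G → τ ≢ σ → ¬ (face σ s ⊆ₑ τ))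

data LeafEquivEmpty {k : ℕ} : Hypergraph k → Set where
  done : ∀ {G} → (∀ τ → τ ∉ G) → LeafEquivEmpty G
  step : ∀ {G} σ → LeafStep G σ → LeafEquivEmpty (G ∖ σ) → LeafEquivEmpty G

-- Let t(σ) ∈ [0,k) be the residue with Σσ ≡ a + t (mod r), and let the special face of σ omit its
-- (t+1)-st smallest vertex x. If another hyperedge τ contains that face, τ trades x for a vertex y,
-- and the bounds 1 ≤ vertex ≤ r force t(τ) − t(σ) = y − x exactly. The potential
-- Φ(σ) = 2 Σ_{i<j} max(σᵢ, σⱼ) − t(σ)² then drops strictly from σ to τ: writing S(z) = Σ_{f ∈ F} max(z, f)
-- over the shared face F, the increment S(z+1) − S(z) is the number of f ≤ z, which grows by at most
-- one per step since F has distinct entries; so moving z by d changes S by d·t up to the triangular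
-- number d(d−1)/2, and the −t² term wins. Hence a hyperedge of minimal potential has a free special
-- face, and removing such leaves one at a time empties every sub-hypergraph of Γ^a_{k,r}.

module Submission where

open import Defs
open import Function using (_∘_; _∘′_)
open import Function.Bundles using (_⇔_; Equivalence)
open import Data.Nat
open import Data.Nat.Properties
open import Algebra.Properties.CommutativeSemigroup +-commutativeSemigroup using (xy∙z≈xz∙y)
open import Data.Nat.DivMod using (_%_; _/_; %-distribˡ-+; m%n%n≡m%n; m≡m%n+[m/n]*n; m<n⇒m%n≡m; [m+n]%n≡m%n)
open import Data.Nat.Induction using (<-wellFounded)
open import Data.Nat.ListAction using (sum)
open import Data.Nat.Tactic.RingSolver using (solve-∀)
open import Data.Fin using (Fin; zero; suc; toℕ; fromℕ<)
open import Data.Fin.Properties using (toℕ-fromℕ<; toℕ-injective)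
open import Data.Vec using (Vec; []; _∷_; toList; lookup)
open import Data.Vec.Properties using (toList-injective; length-toList; cast-is-id; ≡-dec)
open import Data.Vec.Membership.Propositional.Properties using (∈-lookup; ∈-toList⁺)
open import Data.List using (List; []; _∷_; length; map)
open import Data.List.Properties using (∷-injectiveˡ; ∷-injectiveʳ; filter-notAll)
open import Data.List.Extrema.Nat using (argmin; argmin-sel; f[argmin]≤f[⊤]; f[argmin]≤f[xs])
open import Data.List.Membership.Propositional using (_∈_)
open import Data.List.Relation.Binary.Subset.Propositional using (_⊆_)
open import Data.List.Relation.Unary.Any using (here; there)
import Data.List.Relation.Unary.Any as Any
open import Data.List.Relation.Unary.All using (All; []; _∷_)
import Data.List.Relation.Unary.All as All
open import Data.List.Relation.Unary.All.Properties using (anti-mono; filter⁺)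
open import Data.List.Relation.Unary.AllPairs using (AllPairs; []; _∷_)
open import Data.List.Relation.Unary.Linked using (Linked; []; [-]; _∷_)
open import Data.List.Relation.Unary.Linked.Properties using (Linked⇒AllPairs)
open import Data.Product using (Σ; ∃; _×_; _,_; proj₁; proj₂)
open import Data.Sum using ([_,_]′)
open import Induction.WellFounded using (Acc; acc)
open import Relation.Binary using (tri<; tri≈; tri>)
open import Relation.Binary.PropositionalEquality
open import Relation.Nullary using (¬_; ¬?; yes; no; contradiction)
open import Relation.Unary using (Decidable)

atMost : ℕ → List ℕ → ℕ
atMost z []      = 0
atMost z (f ∷ F) with f ≤? z
... | yes _ = suc (atMost z F)
... | no  _ = atMost z F

joinSum : ℕ → List ℕ → ℕ
joinSum z F = sum (map (z ⊔_) F)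

pairMaxSum : List ℕ → ℕ
pairMaxSum []      = 0
pairMaxSum (f ∷ F) = joinSum f F + pairMaxSum F

atMost-none : ∀ {z F} → All (z <_) F → atMost z F ≡ 0
atMost-none []                       = refl
atMost-none {z} {f ∷ _} (z<f ∷ z<F) with f ≤? z
... | yes f≤z = contradiction f≤z (<⇒≱ z<f)
... | no  _   = atMost-none z<F

atMost-suc : ∀ {F} z → AllPairs _<_ F → atMost (suc z) F ≤ suc (atMost z F)
atMost-suc z [] = z≤n
atMost-suc {f ∷ _} z (f<F ∷ F↑) with f ≤? suc z | f ≤? z
... | yes _   | yes _   = s≤s (atMost-suc z F↑)
... | yes f≤1+z | no f≰z = s≤s (≤-trans (≤-reflexive (atMost-none 1+z<F)) z≤n)
  where 1+z<F = subst (λ w → All (w <_) _) (≤-antisym f≤1+z (≰⇒> f≰z)) f<F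
... | no f≰1+z | yes f≤z = contradiction (m≤n⇒m≤1+n f≤z) f≰1+z
... | no  _   | no  _   = atMost-suc z F↑

atMost-+ : ∀ {F} z d → AllPairs _<_ F → atMost (z + d) F ≤ atMost z F + d
atMost-+ {F} z zero    F↑ rewrite +-identityʳ z | +-identityʳ (atMost z F) = ≤-refl
atMost-+ {F} z (suc d) F↑ = begin
  atMost (z + suc d) F       ≡⟨ cong (λ w → atMost w F) (+-suc z d) ⟩
  atMost (suc (z + d)) F     ≤⟨ atMost-suc (z + d) F↑ ⟩
  suc (atMost (z + d) F)     ≤⟨ s≤s (atMost-+ z d F↑) ⟩
  suc (atMost z F + d)       ≡⟨ +-suc (atMost z F) d ⟨
  atMost z F + suc d         ∎
  where open ≤-Reasoning

joinSum-suc : ∀ z F → joinSum (suc z) F ≡ joinSum z F + atMost z F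
joinSum-suc z [] = refl
joinSum-suc z (f ∷ F) with f ≤? z
... | yes f≤z = begin
  suc z ⊔ f + joinSum (suc z) F          ≡⟨ cong₂ _+_ (m≥n⇒m⊔n≡m (m≤n⇒m≤1+n f≤z)) (joinSum-suc z F) ⟩
  suc z + (joinSum z F + atMost z F)      ≡⟨ shuffle z (joinSum z F) (atMost z F) ⟩
  z + joinSum z F + suc (atMost z F)      ≡⟨ cong (λ w → w + _ + _) (m≥n⇒m⊔n≡m f≤z) ⟨
  z ⊔ f + joinSum z F + suc (atMost z F)  ∎
  where
  open ≡-Reasoning
  shuffle : ∀ a b c → suc a + (b + c) ≡ a + b + suc c
  shuffle = solve-∀
... | no f≰z = begin
  suc z ⊔ f + joinSum (suc z) F  ≡⟨ cong₂ _+_ (m≤n⇒m⊔n≡n (≰⇒> f≰z)) (joinSum-suc z F) ⟩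
  f + (joinSum z F + atMost z F)  ≡⟨ +-assoc f _ _ ⟨
  f + joinSum z F + atMost z F    ≡⟨ cong (λ w → w + _ + _) (m≤n⇒m⊔n≡n (<⇒≤ (≰⇒> f≰z))) ⟨
  z ⊔ f + joinSum z F + atMost z F  ∎
  where open ≡-Reasoning

joinSum-+-upper : ∀ {F} x d → AllPairs _<_ F →
  2 * joinSum (x + d) F + d ≤ 2 * joinSum x F + 2 * d * atMost x F + d * d
joinSum-+-upper {F} x zero F↑ rewrite +-identityʳ x = m≤m+n _ _
joinSum-+-upper {F} x (suc d) F↑ = begin
  2 * joinSum (x + suc d) F + suc d
    ≡⟨ cong (λ s → 2 * s + suc d) (trans (cong (λ w → joinSum w F) (+-suc x d)) (joinSum-suc (x + d) F)) ⟩
  2 * (joinSum (x + d) F + atMost (x + d) F) + suc d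
    ≡⟨ regroup (joinSum (x + d) F) (atMost (x + d) F) d ⟩
  (2 * joinSum (x + d) F + d) + suc (2 * atMost (x + d) F)
    ≤⟨ +-mono-≤ (joinSum-+-upper x d F↑) (s≤s (*-monoʳ-≤ 2 (atMost-+ x d F↑))) ⟩
  (2 * joinSum x F + 2 * d * atMost x F + d * d) + suc (2 * (atMost x F + d))
    ≡⟨ collect (joinSum x F) (atMost x F) d ⟩
  2 * joinSum x F + 2 * suc d * atMost x F + suc d * suc d ∎
  where
  open ≤-Reasoning
  regroup : ∀ s l d → 2 * (s + l) + suc d ≡ (2 * s + d) + suc (2 * l)
  regroup = solve-∀
  collect : ∀ s l d → (2 * s + 2 * d * l + d * d) + suc (2 * (l + d)) ≡ 2 * s + 2 * suc d * l + suc d * suc d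
  collect = solve-∀

joinSum-+-lower : ∀ {F} y m → AllPairs _<_ F →
  2 * joinSum y F + 2 * suc m * atMost (y + m) F + suc m ≤ 2 * joinSum (y + suc m) F + suc m * suc m
joinSum-+-lower {F} y zero F↑ = ≤-reflexive (begin
  2 * joinSum y F + 2 * 1 * atMost (y + 0) F + 1
    ≡⟨ cong (λ w → 2 * joinSum y F + 2 * 1 * atMost w F + 1) (+-identityʳ y) ⟩
  2 * joinSum y F + 2 * 1 * atMost y F + 1
    ≡⟨ regroup (joinSum y F) (atMost y F) ⟩
  2 * (joinSum y F + atMost y F) + 1
    ≡⟨ cong (λ s → 2 * s + 1) (trans (cong (λ w → joinSum w F) (+-comm y 1)) (joinSum-suc y F)) ⟨
  2 * joinSum (y + 1) F + 1 ∎)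
  where
  open ≡-Reasoning
  regroup : ∀ s l → 2 * s + 2 * 1 * l + 1 ≡ 2 * (s + l) + 1
  regroup = solve-∀
joinSum-+-lower {F} y (suc m) F↑ = begin
  2 * joinSum y F + 2 * suc (suc m) * atMost (y + suc m) F + suc (suc m)
    ≤⟨ regroup (joinSum y F) (atMost y F) (atMost (y + suc m) F) m (atMost-+ y (suc m) F↑) ⟩
  2 * (joinSum y F + atMost y F) + 2 * suc m * atMost (y + suc m) F + suc m + suc (2 * suc m)
    ≡⟨ cong₂ (λ s l → 2 * s + 2 * suc m * l + suc m + suc (2 * suc m))
             (sym (joinSum-suc y F)) (cong (λ w → atMost w F) (+-suc y m)) ⟩
  2 * joinSum (suc y) F + 2 * suc m * atMost (suc y + m) F + suc m + suc (2 * suc m)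
    ≤⟨ +-monoˡ-≤ (suc (2 * suc m)) (joinSum-+-lower (suc y) m F↑) ⟩
  2 * joinSum (suc y + suc m) F + suc m * suc m + suc (2 * suc m)
    ≡⟨ cong (λ w → 2 * joinSum w F + suc m * suc m + suc (2 * suc m)) (+-suc y (suc m)) ⟨
  2 * joinSum (y + suc (suc m)) F + suc m * suc m + suc (2 * suc m)
    ≡⟨ +-assoc (2 * joinSum (y + suc (suc m)) F) _ _ ⟩
  2 * joinSum (y + suc (suc m)) F + (suc m * suc m + suc (2 * suc m))
    ≡⟨ cong (2 * joinSum (y + suc (suc m)) F +_) (square-suc (suc m)) ⟩
  2 * joinSum (y + suc (suc m)) F + suc (suc m) * suc (suc m) ∎
  where
  open ≤-Reasoning
  regroup : ∀ s l l′ m → l′ ≤ l + suc m →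
    2 * s + 2 * suc (suc m) * l′ + suc (suc m) ≤ 2 * (s + l) + 2 * suc m * l′ + suc m + suc (2 * suc m)
  regroup s l l′ m l′≤ = begin
    2 * s + 2 * suc (suc m) * l′ + suc (suc m)                  ≡⟨ e₁ s l′ m ⟩
    (2 * s + 2 * suc m * l′ + suc m) + suc (2 * l′)              ≤⟨ +-monoʳ-≤ _ (s≤s (*-monoʳ-≤ 2 l′≤)) ⟩
    (2 * s + 2 * suc m * l′ + suc m) + suc (2 * (l + suc m))     ≡⟨ e₂ s l l′ m ⟩
    2 * (s + l) + 2 * suc m * l′ + suc m + suc (2 * suc m)       ∎
    where
    e₁ : ∀ s l′ m →
      2 * s + 2 * suc (suc m) * l′ + suc (suc m) ≡ (2 * s + 2 * suc m * l′ + suc m) + suc (2 * l′)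
    e₁ = solve-∀
    e₂ : ∀ s l l′ m → (2 * s + 2 * suc m * l′ + suc m) + suc (2 * (l + suc m)) ≡
                      2 * (s + l) + 2 * suc m * l′ + suc m + suc (2 * suc m)
    e₂ = solve-∀
  square-suc : ∀ d → d * d + suc (2 * d) ≡ suc d * suc d
  square-suc = solve-∀

vsum≡sum : ∀ {n} (v : Vec ℕ n) → vsum v ≡ sum (toList v)
vsum≡sum []       = refl
vsum≡sum (x ∷ xs) = cong (x +_) (vsum≡sum xs)

vsum-face : ∀ {n} (v : Vec ℕ (suc n)) i → vsum v ≡ sum (face v i) + lookup v i
vsum-face (x ∷ xs)            zero    = trans (+-comm x (vsum xs)) (cong (_+ x) (vsum≡sum xs))
vsum-face (x ∷ xs@(_ ∷ _)) (suc i) = trans (cong (x +_) (vsum-face xs i)) (sym (+-assoc x _ _))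

joinSum-face : ∀ {n} z (v : Vec ℕ (suc n)) i →
  joinSum z (toList v) ≡ joinSum z (face v i) + (z ⊔ lookup v i)
joinSum-face z (x ∷ xs)            zero    = +-comm (z ⊔ x) _
joinSum-face z (x ∷ xs@(_ ∷ _)) (suc i) =
  trans (cong (z ⊔ x +_) (joinSum-face z xs i)) (sym (+-assoc (z ⊔ x) _ _))

pairMaxSum-face : ∀ {n} (v : Vec ℕ (suc n)) i →
  pairMaxSum (toList v) ≡ pairMaxSum (face v i) + joinSum (lookup v i) (face v i)
pairMaxSum-face (x ∷ xs)            zero    = +-comm (joinSum x (toList xs)) _
pairMaxSum-face (x ∷ xs@(_ ∷ _)) (suc i) = begin
  joinSum x (toList xs) + pairMaxSum (toList xs)
    ≡⟨ cong₂ _+_ (joinSum-face x xs i) (pairMaxSum-face xs i) ⟩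
  joinSum x F + (x ⊔ y) + (pairMaxSum F + joinSum y F)
    ≡⟨ cong (λ w → joinSum x F + w + (pairMaxSum F + joinSum y F)) (⊔-comm x y) ⟩
  joinSum x F + (y ⊔ x) + (pairMaxSum F + joinSum y F)
    ≡⟨ interchange (joinSum x F) (y ⊔ x) (pairMaxSum F) (joinSum y F) ⟩
  joinSum x F + pairMaxSum F + (y ⊔ x + joinSum y F) ∎
  where
  open ≡-Reasoning
  F = face xs i
  y = lookup xs i
  interchange : ∀ a b c d → a + b + (c + d) ≡ a + c + (b + d)
  interchange = solve-∀

face⊆ : ∀ {n} (v : Vec ℕ (suc n)) i → face v i ⊆ toList v
face⊆ (x ∷ xs)            zero    z∈          = there z∈
face⊆ (x ∷ xs@(_ ∷ _)) (suc i) (here z≡x)  = here z≡x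
face⊆ (x ∷ xs@(_ ∷ _)) (suc i) (there z∈) = there (face⊆ xs i z∈)

length-face : ∀ {n} (v : Vec ℕ (suc n)) i → length (face v i) ≡ n
length-face (x ∷ xs)            zero    = length-toList xs
length-face (x ∷ xs@(_ ∷ _)) (suc i) = cong suc (length-face xs i)

face-lookup-injective : ∀ {n} (u v : Vec ℕ (suc n)) i →
  face u i ≡ face v i → lookup u i ≡ lookup v i → u ≡ v
face-lookup-injective (x ∷ xs) (y ∷ ys) zero faces≡ x≡y =
  cong₂ _∷_ x≡y (trans (sym (cast-is-id refl xs)) (toList-injective refl xs ys faces≡))
face-lookup-injective (x ∷ xs@(_ ∷ _)) (y ∷ ys@(_ ∷ _)) (suc i) faces≡ lookups≡ =
  cong₂ _∷_ (∷-injectiveˡ faces≡) (face-lookup-injective xs ys i (∷-injectiveʳ faces≡) lookups≡)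

lookup∈toList : ∀ {n} (v : Vec ℕ n) i → lookup v i ∈ toList v
lookup∈toList v i = ∈-toList⁺ (∈-lookup i v)

face-AllPairs : ∀ {n} (v : Vec ℕ (suc n)) i → AllPairs _<_ (toList v) → AllPairs _<_ (face v i)
face-AllPairs (x ∷ xs)            zero    (_ ∷ xs↑)    = xs↑
face-AllPairs (x ∷ xs@(_ ∷ _)) (suc i) (x<xs ∷ xs↑) =
  anti-mono (face⊆ xs i) x<xs ∷ face-AllPairs xs i xs↑

atMost-lookup-face : ∀ {n} (v : Vec ℕ (suc n)) i → AllPairs _<_ (toList v) →
  atMost (lookup v i) (face v i) ≡ toℕ i
atMost-lookup-face (x ∷ xs) zero (x<xs ∷ _) = atMost-none x<xs
atMost-lookup-face (x ∷ xs@(_ ∷ _)) (suc i) (x<xs ∷ xs↑) with x ≤? lookup xs i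
... | yes _   = cong suc (atMost-lookup-face xs i xs↑)
... | no  x≰y = contradiction (<⇒≤ (All.lookup x<xs (lookup∈toList xs i))) x≰y

toℕ≤atMost-face : ∀ {n} (v : Vec ℕ (suc n)) i {z} → AllPairs _<_ (toList v) →
  lookup v i ≤ suc z → toℕ i ≤ atMost z (face v i)
toℕ≤atMost-face (x ∷ xs) zero _ _ = z≤n
toℕ≤atMost-face (x ∷ xs@(_ ∷ _)) (suc i) {z} (x<xs ∷ xs↑) y≤1+z with x ≤? z
... | yes _   = s≤s (toℕ≤atMost-face xs i xs↑ y≤1+z)
... | no  x≰z = contradiction (≤-pred (<-≤-trans (All.lookup x<xs (lookup∈toList xs i)) y≤1+z)) x≰z

lookup-lower : ∀ {n b} (v : Vec ℕ n) i → AllPairs _<_ (toList v) → All (b ≤_) (toList v) →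
  b + toℕ i ≤ lookup v i
lookup-lower {b = b} (x ∷ xs) zero _ (b≤x ∷ _) = ≤-trans (≤-reflexive (+-identityʳ b)) b≤x
lookup-lower {b = b} (x ∷ xs) (suc i) (x<xs ∷ xs↑) (b≤x ∷ _) = begin
  b + suc (toℕ i)   ≡⟨ +-suc b (toℕ i) ⟩
  suc b + toℕ i     ≤⟨ lookup-lower xs i xs↑ (All.map (≤-trans (s≤s b≤x)) x<xs) ⟩
  lookup xs i       ∎
  where open ≤-Reasoning

lookup-upper : ∀ {n c} (v : Vec ℕ (suc n)) i → AllPairs _<_ (toList v) → All (_≤ c) (toList v) →
  lookup v i + n ≤ c + toℕ i
lookup-upper {c = c} (x ∷ []) zero _ (x≤c ∷ _) = +-mono-≤ x≤c ≤-refl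
lookup-upper {suc n} {c} (x ∷ xs@(y ∷ _)) zero (x<xs ∷ xs↑) (_ ∷ xs≤c) = begin
  x + suc n  ≡⟨ +-suc x n ⟩
  suc x + n  ≤⟨ +-monoˡ-≤ n (All.lookup x<xs (here refl)) ⟩
  y + n      ≤⟨ lookup-upper xs zero xs↑ xs≤c ⟩
  c + 0      ∎
  where open ≤-Reasoning
lookup-upper {suc n} {c} (x ∷ xs@(_ ∷ _)) (suc i) (_ ∷ xs↑) (_ ∷ xs≤c) = begin
  lookup xs i + suc n   ≡⟨ +-suc (lookup xs i) n ⟩
  suc (lookup xs i + n) ≤⟨ s≤s (lookup-upper xs i xs↑ xs≤c) ⟩
  suc (c + toℕ i)       ≡⟨ +-suc c (toℕ i) ⟨
  c + suc (toℕ i)       ∎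
  where open ≤-Reasoning

sorted-face-lookup-injective : ∀ {n} (u v : Vec ℕ (suc n)) i j →
  AllPairs _<_ (toList u) → AllPairs _<_ (toList v) → face u i ≡ face v j → lookup u i ≡ lookup v j → u ≡ v
sorted-face-lookup-injective u v i j u↑ v↑ faces≡ lookups≡
  with toℕ-injective (begin
    toℕ i                           ≡⟨ atMost-lookup-face u i u↑ ⟨
    atMost (lookup u i) (face u i)  ≡⟨ cong₂ atMost lookups≡ faces≡ ⟩
    atMost (lookup v j) (face v j)  ≡⟨ atMost-lookup-face v j v↑ ⟩
    toℕ j                           ∎)
  where open ≡-Reasoning
... | refl = face-lookup-injective u v i faces≡ lookups≡

⊆-tail : ∀ {z F T} → All (z <_) F → F ⊆ z ∷ T → F ⊆ T
⊆-tail z<F F⊆ g∈F with F⊆ g∈F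
... | here refl = contradiction (All.lookup z<F g∈F) (<-irrefl refl)
... | there g∈T = g∈T

<-⊆-tail : ∀ {z f F T} → AllPairs _<_ (z ∷ T) → All (f <_) F → f ∈ T → f ∷ F ⊆ z ∷ T → f ∷ F ⊆ T
<-⊆-tail (z<T ∷ _) f<F f∈T = ⊆-tail (z<f ∷ All.map (<-trans z<f) f<F)
  where z<f = All.lookup z<T f∈T

sorted-⊆⇒length≤ : ∀ {F T} → AllPairs _<_ F → AllPairs _<_ T → F ⊆ T → length F ≤ length T
sorted-⊆⇒length≤ {[]} _ _ _ = z≤n
sorted-⊆⇒length≤ {f ∷ F} {T} (f<F ∷ F↑) T↑ F⊆ with F⊆ (here refl) | T↑
... | here refl  | _ ∷ T′↑ = s≤s (sorted-⊆⇒length≤ F↑ T′↑ (⊆-tail f<F (F⊆ ∘ there)))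
... | there f∈T′ | _ ∷ T′↑ =
  m≤n⇒m≤1+n (sorted-⊆⇒length≤ (f<F ∷ F↑) T′↑ (<-⊆-tail T↑ f<F f∈T′ F⊆))

sorted-⊆⇒≡ : ∀ {F T} → AllPairs _<_ F → AllPairs _<_ T → F ⊆ T → length F ≡ length T → F ≡ T
sorted-⊆⇒≡ {[]} {[]} _ _ _ _ = refl
sorted-⊆⇒≡ {f ∷ F} {T} (f<F ∷ F↑) T↑ F⊆ |F|≡|T| with F⊆ (here refl) | T↑
... | here refl  | _ ∷ T′↑ =
  cong (f ∷_) (sorted-⊆⇒≡ F↑ T′↑ (⊆-tail f<F (F⊆ ∘ there)) (suc-injective |F|≡|T|))
... | there f∈T′ | _ ∷ T′↑ = contradiction
  (sorted-⊆⇒length≤ (f<F ∷ F↑) T′↑ (<-⊆-tail T↑ f<F f∈T′ F⊆)) (<⇒≱ (≤-reflexive (sym |F|≡|T|)))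

sorted-⊆⇒face : ∀ {n F} (τ : Vec ℕ (suc n)) → AllPairs _<_ F → AllPairs _<_ (toList τ) →
  F ⊆ toList τ → length F ≡ n → ∃ λ s → face τ s ≡ F
sorted-⊆⇒face {F = []} (z ∷ []) _ _ _ refl = zero , refl
sorted-⊆⇒face {F = f ∷ F} (z ∷ τ) (f<F ∷ F↑) τ↑@(_ ∷ τ↑′) F⊆ refl with F⊆ (here refl)
... | here refl
  with s , face≡ ← sorted-⊆⇒face τ F↑ τ↑′ (⊆-tail f<F (F⊆ ∘ there)) refl = suc s , cong (f ∷_) face≡
... | there f∈τ =
  zero , sym (sorted-⊆⇒≡ (f<F ∷ F↑) τ↑′ (<-⊆-tail τ↑ f<F f∈τ F⊆) (sym (length-toList τ)))

[m+n]%d≡[m%d+n]%d : ∀ m n d .{{_ : NonZero d}} → (m + n) % d ≡ (m % d + n) % d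
[m+n]%d≡[m%d+n]%d m n d = begin
  (m + n) % d               ≡⟨ %-distribˡ-+ m n d ⟩
  (m % d + n % d) % d       ≡⟨ cong (λ w → (w + n % d) % d) (m%n%n≡m%n m d) ⟨
  (m % d % d + n % d) % d   ≡⟨ %-distribˡ-+ (m % d) n d ⟨
  (m % d + n) % d           ∎
  where open ≡-Reasoning

m%d≡o∧m<d+o⇒m≡o : ∀ {m o} d .{{_ : NonZero d}} → m % d ≡ o → m < d + o → m ≡ o
m%d≡o∧m<d+o⇒m≡o {m} {o} d m%d≡o m<d+o with m / d | m≡m%n+[m/n]*n m d
... | zero  | m≡ = trans m≡ (trans (+-identityʳ (m % d)) m%d≡o)
... | suc q | m≡ = contradiction m<d+o (≤⇒≯ (begin
  d + o              ≤⟨ m≤n+m (d + o) (q * d) ⟩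
  q * d + (d + o)    ≡⟨ regroup q d o ⟩
  o + suc q * d      ≡⟨ cong (_+ suc q * d) m%d≡o ⟨
  m % d + suc q * d  ≡⟨ m≡ ⟨
  m                  ∎))
  where
  open ≤-Reasoning
  regroup : ∀ q d o → q * d + (d + o) ≡ o + suc q * d
  regroup = solve-∀

exchange-∸ : ∀ {a b m n} K → a + m < b + n → m ≤ K → n ≤ K → a + (K ∸ n) < b + (K ∸ m)
exchange-∸ {a} {b} {m} {n} K a+m<b+n m≤K n≤K = +-cancelʳ-≤ (m + n) _ _ (begin
  suc (a + (K ∸ n)) + (m + n)   ≡⟨ e₁ a m (K ∸ n) n ⟩
  suc (a + m) + ((K ∸ n) + n)   ≡⟨ cong (suc (a + m) +_) (m∸n+n≡m n≤K) ⟩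
  suc (a + m) + K               ≤⟨ +-monoˡ-≤ K a+m<b+n ⟩
  b + n + K                     ≡⟨ cong (b + n +_) (m∸n+n≡m m≤K) ⟨
  b + n + ((K ∸ m) + m)         ≡⟨ e₂ b n (K ∸ m) m ⟩
  b + (K ∸ m) + (m + n)         ∎)
  where
  open ≤-Reasoning
  e₁ : ∀ a m k n → suc (a + k) + (m + n) ≡ suc (a + m) + (k + n)
  e₁ = solve-∀
  e₂ : ∀ b n k m → b + n + (k + m) ≡ b + k + (m + n)
  e₂ = solve-∀

square-up : ∀ {Sx Sy t d} → 0 < d → 2 * Sy + d ≤ 2 * Sx + 2 * d * t + d * d →
  2 * Sy + t * t < 2 * Sx + (t + d) * (t + d)
square-up {Sx} {Sy} {t} {d} 0<d h = begin-strict
  2 * Sy + t * t                 <⟨ +-monoʳ-< (2 * Sy) (m<m+n (t * t) 0<d) ⟩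
  2 * Sy + (t * t + d)           ≡⟨ e₁ Sy t d ⟩
  (2 * Sy + d) + t * t           ≤⟨ +-monoˡ-≤ (t * t) h ⟩
  2 * Sx + 2 * d * t + d * d + t * t ≡⟨ e₂ Sx t d ⟩
  2 * Sx + (t + d) * (t + d)     ∎
  where
  open ≤-Reasoning
  e₁ : ∀ s t d → 2 * s + (t * t + d) ≡ (2 * s + d) + t * t
  e₁ = solve-∀
  e₂ : ∀ s t d → 2 * s + 2 * d * t + d * d + t * t ≡ 2 * s + (t + d) * (t + d)
  e₂ = solve-∀

square-down : ∀ {Sx Sy t d} → 0 < d → 2 * Sy + 2 * d * (t + d) + d ≤ 2 * Sx + d * d →
  2 * Sy + (t + d) * (t + d) < 2 * Sx + t * t
square-down {Sx} {Sy} {t} {d} 0<d h = +-cancelʳ-≤ (d * d) _ _ (begin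
  suc (2 * Sy + (t + d) * (t + d)) + d * d  ≤⟨ +-monoˡ-≤ (d * d) (m<m+n (2 * Sy + (t + d) * (t + d)) 0<d) ⟩
  2 * Sy + (t + d) * (t + d) + d + d * d    ≡⟨ e₁ Sy t d ⟩
  (2 * Sy + 2 * d * (t + d) + d) + t * t    ≤⟨ +-monoˡ-≤ (t * t) h ⟩
  2 * Sx + d * d + t * t                    ≡⟨ e₂ Sx t d ⟩
  2 * Sx + t * t + d * d                    ∎)
  where
  open ≤-Reasoning
  e₁ : ∀ s t d → 2 * s + (t + d) * (t + d) + d + d * d ≡ (2 * s + 2 * d * (t + d) + d) + t * t
  e₁ = solve-∀
  e₂ : ∀ s t d → 2 * s + d * d + t * t ≡ 2 * s + t * t + d * d
  e₂ = solve-∀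

+-exchange : ∀ {A B S x y d} → A ≡ S + x → B ≡ S + y → y ≡ x + d → B ≡ A + d
+-exchange {A} {B} {S} {x} {y} {d} A≡S+x B≡S+y y≡x+d = begin
  B            ≡⟨ B≡S+y ⟩
  S + y        ≡⟨ cong (S +_) y≡x+d ⟩
  S + (x + d)  ≡⟨ +-assoc S x d ⟨
  S + x + d    ≡⟨ cong (_+ d) A≡S+x ⟨
  A + d        ∎
  where open ≡-Reasoning

Increasing⇒Linked : ∀ {k} {v : Vec ℕ k} → Increasing v → Linked _<_ (toList v)
Increasing⇒Linked inc[]               = []
Increasing⇒Linked (inc[x] _)          = [-]
Increasing⇒Linked (inc∷ _ _ _ x<y ys↑) = x<y ∷ Increasing⇒Linked ys↑

Increasing⇒AllPairs : ∀ {k} {v : Vec ℕ k} → Increasing v → AllPairs _<_ (toList v)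
Increasing⇒AllPairs = Linked⇒AllPairs <-trans ∘′ Increasing⇒Linked

InRange⇒All : ∀ {r k} {v : Vec ℕ k} → InRange r v → All (λ x → 1 ≤ x × x ≤ r) (toList v)
InRange⇒All rng[]                  = []
InRange⇒All (rng∷ _ _ 1≤x x≤r xs∈) = (1≤x , x≤r) ∷ InRange⇒All xs∈

removable? : ∀ {k} (σ : Hyperedge k) → Decidable (λ τ → ¬ τ ≡ σ)
removable? σ τ = ¬? (≡-dec _≟_ τ σ)

length-∖ : ∀ {k} {G : Hypergraph k} {σ} → σ ∈ G → length (G ∖ σ) < length G
length-∖ {G = G} {σ} σ∈G = filter-notAll (removable? σ) G (Any.map (λ σ≡τ τ≢σ → τ≢σ (sym σ≡τ)) σ∈G)

All-∖ : ∀ {k} {P : Hyperedge k → Set} {G : Hypergraph k} σ → All P G → All P (G ∖ σ)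
All-∖ σ = filter⁺ (removable? σ)

collapse : ∀ {k} (P : Hyperedge k → Set) →
  (∀ G → All P G → (∃ λ τ → τ ∈ G) → ∃ λ σ → LeafStep G σ) →
  ∀ G → All P G → LeafEquivEmpty G
collapse P leaf G = go G (<-wellFounded (length G))
  where
  go : ∀ G → Acc _<_ (length G) → All P G → LeafEquivEmpty G
  go [] _ _ = done (λ _ ())
  go G@(g ∷ _) (acc shrinks) G⊆P with σ , leafσ@(σ∈G , _) ← leaf G G⊆P (g , here refl) =
    step σ leafσ (go (G ∖ σ) (shrinks (length-∖ σ∈G)) (All-∖ σ G⊆P))

module LeafRemoval (n r a : ℕ) .{{_ : NonZero r}} (k≤r : suc n ≤ r) (a<r : a < r) where

  Edge : Hyperedge (suc n) → Set
  Edge = IsEdgeΓ (suc n) r a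

  -- The t of the paper: adding r ∸ a subtracts a modulo r.
  shift : Hyperedge (suc n) → ℕ
  shift σ = (vsum σ + (r ∸ a)) % r

  shift<k : ∀ {σ} → Edge σ → shift σ < suc n
  shift<k {σ} (_ , _ , t , t<k , σ≡a+t) = subst (_< suc n) (sym shift≡t) t<k
    where
    open ≡-Reasoning
    shift≡t : shift σ ≡ t
    shift≡t = begin
      (vsum σ + (r ∸ a)) % r        ≡⟨ [m+n]%d≡[m%d+n]%d (vsum σ) (r ∸ a) r ⟩
      (vsum σ % r + (r ∸ a)) % r    ≡⟨ cong (λ w → (w + (r ∸ a)) % r) σ≡a+t ⟩
      ((a + t) % r + (r ∸ a)) % r   ≡⟨ [m+n]%d≡[m%d+n]%d (a + t) (r ∸ a) r ⟨
      (a + t + (r ∸ a)) % r         ≡⟨ cong (_% r) (xy∙z≈xz∙y a t (r ∸ a)) ⟩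
      (a + (r ∸ a) + t) % r         ≡⟨ cong (λ w → (w + t) % r) (m+[n∸m]≡n (<⇒≤ a<r)) ⟩
      (r + t) % r                   ≡⟨ cong (_% r) (+-comm r t) ⟩
      (t + r) % r                   ≡⟨ [m+n]%n≡m%n t r ⟩
      t % r                         ≡⟨ m<n⇒m%n≡m (<-≤-trans t<k k≤r) ⟩
      t                             ∎

  shift-+ : ∀ {σ τ} d → vsum τ ≡ vsum σ + d → shift τ ≡ (shift σ + d) % r
  shift-+ {σ} {τ} d τ≡σ+d = begin
    (vsum τ + (r ∸ a)) % r        ≡⟨ cong (λ s → (s + (r ∸ a)) % r) τ≡σ+d ⟩
    (vsum σ + d + (r ∸ a)) % r    ≡⟨ cong (_% r) (xy∙z≈xz∙y (vsum σ) d (r ∸ a)) ⟩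
    (vsum σ + (r ∸ a) + d) % r    ≡⟨ [m+n]%d≡[m%d+n]%d (vsum σ + (r ∸ a)) d r ⟩
    (shift σ + d) % r             ∎
    where open ≡-Reasoning

  special : ∀ {σ} → Edge σ → Fin (suc n)
  special eσ = fromℕ< (shift<k eσ)

  -- K ∸ t² stands for −t², kept in ℕ since t < k gives t² ≤ K = k².
  potential : Hyperedge (suc n) → ℕ
  potential σ = 2 * pairMaxSum (toList σ) + (suc n * suc n ∸ shift σ * shift σ)

  joinSums<⇒potential< : ∀ {σ τ} i s → Edge σ → Edge τ → face τ s ≡ face σ i →
    2 * joinSum (lookup τ s) (face σ i) + shift σ * shift σ <
      2 * joinSum (lookup σ i) (face σ i) + shift τ * shift τ →
    potential τ < potential σ
  joinSums<⇒potential< {σ} {τ} i s eσ eτ faces≡ joins< = begin-strict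
    potential τ                   ≡⟨ cong (λ q → 2 * q + (K ∸ shift τ * shift τ)) pairsτ ⟩
    2 * (P + Sy) + (K ∸ shift τ * shift τ)
      <⟨ exchange-∸ K (begin-strict
           2 * (P + Sy) + shift σ * shift σ   ≡⟨ distrib P Sy _ ⟩
           2 * P + (2 * Sy + shift σ * shift σ) <⟨ +-monoʳ-< (2 * P) joins< ⟩
           2 * P + (2 * Sx + shift τ * shift τ) ≡⟨ distrib P Sx _ ⟨
           2 * (P + Sx) + shift τ * shift τ   ∎) (shift²≤K eσ) (shift²≤K eτ) ⟩
    2 * (P + Sx) + (K ∸ shift σ * shift σ)
      ≡⟨ cong (λ q → 2 * q + (K ∸ shift σ * shift σ)) (pairMaxSum-face σ i) ⟨
    potential σ                   ∎
    where
    open ≤-Reasoning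
    K = suc n * suc n
    F = face σ i
    P = pairMaxSum F
    Sx = joinSum (lookup σ i) F
    Sy = joinSum (lookup τ s) F
    pairsτ : pairMaxSum (toList τ) ≡ P + Sy
    pairsτ = trans (pairMaxSum-face τ s) (cong (λ G → pairMaxSum G + joinSum (lookup τ s) G) faces≡)
    shift²≤K : ∀ {ρ} → Edge ρ → shift ρ * shift ρ ≤ K
    shift²≤K eρ = *-mono-≤ (<⇒≤ (shift<k eρ)) (<⇒≤ (shift<k eρ))
    distrib : ∀ p q u → 2 * (p + q) + u ≡ 2 * p + (2 * q + u)
    distrib = solve-∀

  module _ {σ τ} (eσ : Edge σ) (eτ : Edge τ) (i s : Fin (suc n))
           (i≡shift : toℕ i ≡ shift σ) (faces≡ : face τ s ≡ face σ i) where

    private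
      F = face σ i
      x = lookup σ i
      y = lookup τ s
      σ↑ = Increasing⇒AllPairs (proj₁ eσ)
      τ↑ = Increasing⇒AllPairs (proj₁ eτ)
      F↑ = face-AllPairs σ i σ↑
      σ-range = InRange⇒All (proj₁ (proj₂ eσ))
      τ-range = InRange⇒All (proj₁ (proj₂ eτ))

      vsumσ : vsum σ ≡ sum F + x
      vsumσ = vsum-face σ i

      vsumτ : vsum τ ≡ sum F + y
      vsumτ = trans (vsum-face τ s) (cong (λ G → sum G + y) faces≡)

    potential-up : ∀ d → 0 < d → y ≡ x + d → potential τ < potential σ
    potential-up d 0<d y≡x+d = joinSums<⇒potential< i s eσ eτ faces≡
      (subst (λ u → 2 * joinSum y F + t * t < 2 * joinSum x F + u * u) (sym shiftτ≡t+d)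
        (square-up {joinSum x F} {joinSum y F} 0<d joinSum-bound))
      where
      open ≤-Reasoning
      t = shift σ
      joinSum-bound : 2 * joinSum y F + d ≤ 2 * joinSum x F + 2 * d * t + d * d
      joinSum-bound = begin
        2 * joinSum y F + d                           ≡⟨ cong (λ z → 2 * joinSum z F + d) y≡x+d ⟩
        2 * joinSum (x + d) F + d                     ≤⟨ joinSum-+-upper x d F↑ ⟩
        2 * joinSum x F + 2 * d * atMost x F + d * d
          ≡⟨ cong (λ l → 2 * joinSum x F + 2 * d * l + d * d) (trans (atMost-lookup-face σ i σ↑) i≡shift) ⟩
        2 * joinSum x F + 2 * d * t + d * d           ∎
      t+d<r : t + d < r
      t+d<r = begin-strict
        t + d   <⟨ +-monoˡ-< d (subst (_≤ x) (cong suc i≡shift) (lookup-lower σ i σ↑ (All.map proj₁ σ-range))) ⟩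
        x + d   ≡⟨ y≡x+d ⟨
        y       ≤⟨ proj₂ (All.lookup τ-range (lookup∈toList τ s)) ⟩
        r       ∎
      shiftτ≡t+d : shift τ ≡ t + d
      shiftτ≡t+d = trans (shift-+ {σ} {τ} d (+-exchange vsumσ vsumτ y≡x+d)) (m<n⇒m%n≡m t+d<r)

    potential-down : ∀ d → 0 < d → x ≡ y + d → potential τ < potential σ
    potential-down d@(suc m) 0<d x≡y+d = joinSums<⇒potential< i s eσ eτ faces≡
      (subst (λ w → 2 * joinSum y F + w * w < 2 * joinSum x F + u * u) u+d≡t
        (square-down {joinSum x F} {joinSum y F} 0<d joinSum-bound))
      where
      open ≤-Reasoning
      t = shift σ
      u = shift τ
      t≤count : t ≤ atMost (y + m) F
      t≤count = subst (_≤ atMost (y + m) F) i≡shift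
        (toℕ≤atMost-face σ i σ↑ (≤-reflexive (trans x≡y+d (+-suc y m))))
      u+d<r+t : u + d < r + t
      u+d<r+t = begin-strict
        u + d       ≤⟨ +-monoˡ-≤ d (≤-pred (shift<k eτ)) ⟩
        n + d       <⟨ +-monoʳ-< n (subst (d <_) (sym x≡y+d) (+-monoˡ-≤ d 1≤y)) ⟩
        n + x       ≡⟨ +-comm n x ⟩
        x + n       ≤⟨ lookup-upper σ i σ↑ (All.map proj₂ σ-range) ⟩
        r + toℕ i   ≡⟨ cong (r +_) i≡shift ⟩
        r + t       ∎
        where 1≤y = proj₁ (All.lookup τ-range (lookup∈toList τ s))
      u+d≡t : u + d ≡ t
      u+d≡t = m%d≡o∧m<d+o⇒m≡o r (sym (shift-+ {τ} {σ} d (+-exchange vsumτ vsumσ x≡y+d))) u+d<r+t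
      joinSum-bound : 2 * joinSum y F + 2 * d * (u + d) + d ≤ 2 * joinSum x F + d * d
      joinSum-bound = begin
        2 * joinSum y F + 2 * d * (u + d) + d          ≡⟨ cong (λ w → 2 * joinSum y F + 2 * d * w + d) u+d≡t ⟩
        2 * joinSum y F + 2 * d * t + d
          ≤⟨ +-monoˡ-≤ d (+-monoʳ-≤ (2 * joinSum y F) (*-monoʳ-≤ (2 * d) t≤count)) ⟩
        2 * joinSum y F + 2 * d * atMost (y + m) F + d  ≤⟨ joinSum-+-lower y m F↑ ⟩
        2 * joinSum (y + d) F + d * d                   ≡⟨ cong (λ z → 2 * joinSum z F + d * d) x≡y+d ⟨
        2 * joinSum x F + d * d                         ∎

    potential-shared-face : τ ≢ σ → potential τ < potential σ
    potential-shared-face τ≢σ with <-cmp x y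
    ... | tri< x<y _ _ = potential-up _ (m<n⇒0<n∸m x<y) (sym (m+[n∸m]≡n (<⇒≤ x<y)))
    ... | tri≈ _ x≡y _ = contradiction (sorted-face-lookup-injective τ σ s i τ↑ σ↑ faces≡ (sym x≡y)) τ≢σ
    ... | tri> _ _ y<x = potential-down _ (m<n⇒0<n∸m y<x) (sym (m+[n∸m]≡n (<⇒≤ y<x)))

  potential-decreasing : ∀ {σ τ} (eσ : Edge σ) → Edge τ → τ ≢ σ →
    face σ (special eσ) ⊆ₑ τ → potential τ < potential σ
  potential-decreasing {σ} {τ} eσ eτ τ≢σ F⊆τ =
    let s , faces≡ = sorted-⊆⇒face τ (face-AllPairs σ i σ↑) τ↑
                                   (∈-toList⁺ ∘ All.lookup F⊆τ) (length-face σ i)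
    in  potential-shared-face eσ eτ i s (toℕ-fromℕ< (shift<k eσ)) faces≡ τ≢σ
    where
    i = special eσ
    σ↑ = Increasing⇒AllPairs (proj₁ eσ)
    τ↑ = Increasing⇒AllPairs (proj₁ eτ)

  leaf-exists : (G : Hypergraph (suc n)) → All Edge G → (∃ λ τ → τ ∈ G) → ∃ λ σ → LeafStep G σ
  leaf-exists (g ∷ G) G-edges _ =
    σ , σ∈ , special eσ , λ τ τ∈ τ≢σ F⊆τ →
      <⇒≱ (potential-decreasing eσ (All.lookup G-edges τ∈) τ≢σ F⊆τ) (σ-minimal τ∈)
    where
    σ = argmin potential g G
    σ∈ : σ ∈ g ∷ G
    σ∈ = [ here , there ]′ (argmin-sel potential g G)
    eσ = All.lookup G-edges σ∈
    σ-minimal : ∀ {τ} → τ ∈ g ∷ G → potential σ ≤ potential τ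
    σ-minimal (here refl) = f[argmin]≤f[⊤] {f = potential} g G
    σ-minimal (there τ∈G) = All.lookup (f[argmin]≤f[xs] {f = potential} g G) τ∈G

lemma4p7 : (k r a : ℕ) .{{_ : NonZero r}} → 1 ≤ k → k ≤ r → a < r →
    ((G : Hypergraph k) → All (IsEdgeΓ k r a) G → (Σ (Hyperedge k) λ τ → τ ∈ G) →
      Σ (Hyperedge k) λ σ → LeafStep G σ)
    × ((Γ : Hypergraph k) → (∀ τ → (τ ∈ Γ) ⇔ IsEdgeΓ k r a τ) → LeafEquivEmpty Γ)
lemma4p7 (suc n) r a (s≤s z≤n) k≤r a<r =
  leaf-exists , λ Γ Γ≡Γᵃ → collapse Edge leaf-exists Γ (All.tabulate (Equivalence.to (Γ≡Γᵃ _)))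
  where open LeafRemoval n r a k≤r a<r
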